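{- Let $p$ be a prime. The sequence $\left(W_{p,m}(x)\,x^{p(1-p)\lfloor m/p\rfloor}\bmod p\right)_{m\in\mathbb{N}}$ (Laurent polynomials with coefficients reduced modulo $p$) is periodic with period length $p$; that is, $W_{p,m}(x)\,x^{p(1-p)\lfloor m/p\rfloor}\equiv W_{p,\,m\bmod p}(x)\pmod p$ for all $m\in\mathbb{N}$. In particular, modulo $2$ the sequence $(W_{2,m}(x)x^{ -2\lfloor m/2\rfloor})_{m}$ is the periodic repetition of $(1,\,1+x)$, and modulo $3$ the sequence $(W_{3,m}(x)x^{ -6\lfloor m/3\rfloor})_m$ is the periodic repetition of $(1,\,1+x^2,\,(x+2)(x^3+x^2+2))$.
   Context: $\mathbb{N}$ denotes the non-negative integers. For an integer $d\ge2$ the polynomials $W_{d,m}(x)\in\mathbb{Z}[x]$ are defined by $W_{d,0}(x)=1$ and $W_{d,m+1}(x)=W_{d,m}'(x)+(1+x^{d-1})W_{d,m}(x)$. -}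

module Defs where

open import Data.Nat using (ℕ; zero; suc; _∸_)
open import Data.Integer using (ℤ; +_; _+_; _*_; _-_)
open import Data.Integer.Divisibility using (_∣_)
open import Data.List using (List; []; _∷_; _++_; replicate; map)

-- Polynomials over ℤ as coefficient lists, lowest degree first.
Poly : Set
Poly = List ℤ

coeff : Poly → ℕ → ℤ
coeff []       _       = + 0
coeff (a ∷ _)  zero    = a
coeff (_ ∷ as) (suc k) = coeff as k

_⊕_ : Poly → Poly → Poly
[]       ⊕ q        = q
(a ∷ as) ⊕ []       = a ∷ as
(a ∷ as) ⊕ (b ∷ bs) = (a + b) ∷ (as ⊕ bs)

_⊗_ : Poly → Poly → Poly
[]       ⊗ q = []
(a ∷ as) ⊗ q = map (a *_) q ⊕ (+ 0 ∷ (as ⊗ q))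

shift : ℕ → Poly → Poly
shift n p = replicate n (+ 0) ++ p

derivAux : ℕ → Poly → Poly
derivAux k []       = []
derivAux k (b ∷ bs) = (+ k * b) ∷ derivAux (suc k) bs

deriv : Poly → Poly
deriv []       = []
deriv (_ ∷ as) = derivAux 1 as

W : ℕ → ℕ → Poly
W d zero    = + 1 ∷ []
W d (suc m) = deriv (W d m) ⊕ (W d m ⊕ shift (d ∸ 1) (W d m))

_≡[mod_]_ : Poly → ℕ → Poly → Set
P ≡[mod n ] Q = ∀ k → (+ n) ∣ (coeff P k - coeff Q k)

per2 : ℕ → Poly
per2 zero    = + 1 ∷ []
per2 (suc _) = + 1 ∷ + 1 ∷ []

per3 : ℕ → Poly
per3 zero          = + 1 ∷ []
per3 (suc zero)    = + 1 ∷ + 0 ∷ + 1 ∷ []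
per3 (suc (suc _)) = (+ 2 ∷ + 1 ∷ []) ⊗ (+ 2 ∷ + 0 ∷ + 1 ∷ + 1 ∷ [])

{-# OPTIONS --safe #-}
-- Write L = 1 + E with E = D + x^(p-1), so that W p m = L^m 1.  Modulo p the
-- binomial theorem gives W p p ≡ 1 + E^p 1.  The polynomial E^m 1 lives in the
-- degrees congruent to -m modulo p, namely E^m 1 = x^(-m) T_m(x^p) where
-- T_(m+1)(y) ≡ (y - m) T_m(y) modulo p; hence T_p is the falling factorial
-- y(y-1)⋯(y-p+1) ≡ y^p - y, so E^p 1 ≡ x^(p(p-1)) - 1 and W p p ≡ x^(p(p-1)).
-- The congruence for the falling factorial is read off from (y+1)_p ≡ (y)_p by
-- comparing coefficients from the top down.  Finally L commutes with
-- multiplication by x^(p(p-1)) modulo p, the commutator being divisible by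
-- p(p-1), so W p (m + p) ≡ x^(p(p-1)) W p m.
module Submission where

open import Defs

-- A separate module, so that the integer operators opened here do not clash
-- with the natural-number ones in the statement of mainTheorem9.
module Periodicity where

  open import Data.Nat as ℕ using (ℕ; zero; suc; _∸_; _<_; _≤_; z≤n; s≤s; NonZero)
  open import Data.Integer as ℤ using (ℤ; +_; _+_; _*_; _-_; -_)
  import Data.Nat.Properties as ℕ
  import Data.Integer.Properties as ℤ
  open import Data.Integer.Tactic.RingSolver using (solve-∀)
  open import Data.List using ([]; _∷_)
  open import Data.Nat.Primality using (Prime; prime?; ¬prime[0]; ¬prime[1])
  open import Data.Nat.DivMod using (_/_; _%_; m≡m%n+[m/n]*n; m%n<n)
  open import Relation.Nullary.Decidable using (from-yes)
  open import Data.Nat.Combinatorics using (_C_; k>n⇒nCk≡0; nCk+nC[k+1]≡[n+1]C[k+1]; nCn≡1; nC1≡n; nCk≡nC[n∸k])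
  open import Relation.Binary.PropositionalEquality
  open import Relation.Nullary using (contradiction; yes; no)
  open import Function using (_∘_)

  [1+k]*[1+n]C[1+k]≡[1+n]*nCk : ∀ n k → suc k ℕ.* (suc n C suc k) ≡ suc n ℕ.* (n C k)
  [1+k]*[1+n]C[1+k]≡[1+n]*nCk zero    zero    = refl
  [1+k]*[1+n]C[1+k]≡[1+n]*nCk zero    (suc k) =
    trans (cong (suc (suc k) ℕ.*_) (k>n⇒nCk≡0 {1} {suc (suc k)} (s≤s (s≤s z≤n))))
          (trans (ℕ.*-zeroʳ (suc (suc k))) (sym (cong (1 ℕ.*_) (k>n⇒nCk≡0 {0} {suc k} (s≤s z≤n)))))
  [1+k]*[1+n]C[1+k]≡[1+n]*nCk (suc n) zero    =
    trans (ℕ.*-identityˡ _) (trans (nC1≡n (suc (suc n))) (sym (ℕ.*-identityʳ (suc (suc n)))))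
  [1+k]*[1+n]C[1+k]≡[1+n]*nCk (suc n) (suc k) = begin
    suc (suc k) ℕ.* (suc (suc n) C suc (suc k))
      ≡⟨ cong (suc (suc k) ℕ.*_) (sym (nCk+nC[k+1]≡[n+1]C[k+1] (suc n) (suc k))) ⟩
    suc (suc k) ℕ.* (X ℕ.+ Y)
      ≡⟨ expand k X Y ⟩
    X ℕ.+ (suc k ℕ.* X ℕ.+ suc (suc k) ℕ.* Y)
      ≡⟨ cong₂ (λ a b → X ℕ.+ (a ℕ.+ b)) ([1+k]*[1+n]C[1+k]≡[1+n]*nCk n k) ([1+k]*[1+n]C[1+k]≡[1+n]*nCk n (suc k)) ⟩
    X ℕ.+ (suc n ℕ.* (n C k) ℕ.+ suc n ℕ.* (n C suc k))
      ≡⟨ cong (X ℕ.+_) (trans (sym (ℕ.*-distribˡ-+ (suc n) (n C k) _))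
                              (cong (suc n ℕ.*_) (nCk+nC[k+1]≡[n+1]C[k+1] n k))) ⟩
    X ℕ.+ suc n ℕ.* X
      ≡⟨⟩
    suc (suc n) ℕ.* X ∎
    where
    open ≡-Reasoning
    open import Data.Nat.Tactic.RingSolver using () renaming (solve-∀ to solveℕ-∀)
    X Y : ℕ
    X = suc n C suc k
    Y = suc n C suc (suc k)
    expand : ∀ k X Y → suc (suc k) ℕ.* (X ℕ.+ Y) ≡ X ℕ.+ (suc k ℕ.* X ℕ.+ suc (suc k) ℕ.* Y)
    expand = solveℕ-∀

  [1+n]Cn≡1+n : ∀ n → suc n C n ≡ suc n
  [1+n]Cn≡1+n n = trans (nCk≡nC[n∸k] (ℕ.n≤1+n n)) (trans (cong (suc n C_) (ℕ.m+n∸n≡m 1 n)) (nC1≡n (suc n)))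

  downward-induction : ∀ {ℓ} (P : ℕ → Set ℓ) b →
                       (∀ k → k ≤ b → (∀ j → k < j → j ≤ b → P j) → P k) →
                       ∀ k → k ≤ b → P k
  downward-induction P b step k = go b k (ℕ.m≤m+n b k)
    where
    go : ∀ d k → b ≤ d ℕ.+ k → k ≤ b → P k
    go zero    k b≤k   k≤b = step k k≤b λ j k<j j≤b → contradiction (ℕ.≤-trans j≤b b≤k) (ℕ.<⇒≱ k<j)
    go (suc d) k b≤d+1+k k≤b = step k k≤b λ j k<j j≤b →
      go d j (ℕ.≤-trans b≤d+1+k (ℕ.≤-trans (ℕ.≤-reflexive (sym (ℕ.+-suc d k))) (ℕ.+-monoʳ-≤ d k<j))) j≤b

  Seq : Set
  Seq = ℕ → ℤ

  shiftᶜ : ℕ → Seq → Seq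
  shiftᶜ zero    f e       = f e
  shiftᶜ (suc n) f zero    = + 0
  shiftᶜ (suc n) f (suc e) = shiftᶜ n f e

  δ₀ : Seq
  δ₀ zero    = + 1
  δ₀ (suc _) = + 0

  shiftᶜ-≥ : ∀ n (f : Seq) {e} → n ≤ e → shiftᶜ n f e ≡ f (e ∸ n)
  shiftᶜ-≥ zero    f _         = refl
  shiftᶜ-≥ (suc n) f (s≤s n≤e) = shiftᶜ-≥ n f n≤e

  shiftᶜ-< : ∀ n (f : Seq) {e} → e < n → shiftᶜ n f e ≡ + 0
  shiftᶜ-< (suc n) f {zero}  _         = refl
  shiftᶜ-< (suc n) f {suc e} (s≤s e<n) = shiftᶜ-< n f e<n

  shiftᶜ-+ : ∀ m n (f : Seq) → shiftᶜ m (shiftᶜ n f) ≗ shiftᶜ (m ℕ.+ n) f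
  shiftᶜ-+ zero    n f e       = refl
  shiftᶜ-+ (suc m) n f zero    = refl
  shiftᶜ-+ (suc m) n f (suc e) = shiftᶜ-+ m n f e

  shiftᶜ-cong : ∀ n {f g : Seq} → f ≗ g → shiftᶜ n f ≗ shiftᶜ n g
  shiftᶜ-cong zero    f≗g e       = f≗g e
  shiftᶜ-cong (suc n) f≗g zero    = refl
  shiftᶜ-cong (suc n) f≗g (suc e) = shiftᶜ-cong n f≗g e

  shiftᶜ-*ˡ : ∀ n c (f : Seq) → shiftᶜ n (λ e → c * f e) ≗ λ e → c * shiftᶜ n f e
  shiftᶜ-*ˡ zero    c f e       = refl
  shiftᶜ-*ˡ (suc n) c f zero    = sym (ℤ.*-zeroʳ c)
  shiftᶜ-*ˡ (suc n) c f (suc e) = shiftᶜ-*ˡ n c f e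

  shiftᶜ-δ₀-≢ : ∀ n {e} → e ≢ n → shiftᶜ n δ₀ e ≡ + 0
  shiftᶜ-δ₀-≢ zero    {zero}  e≢n = contradiction refl e≢n
  shiftᶜ-δ₀-≢ zero    {suc e} _   = refl
  shiftᶜ-δ₀-≢ (suc n) {zero}  _   = refl
  shiftᶜ-δ₀-≢ (suc n) {suc e} e≢n = shiftᶜ-δ₀-≢ n (e≢n ∘ cong suc)

  shiftᶜ-δ₀-≡ : ∀ n → shiftᶜ n δ₀ n ≡ + 1
  shiftᶜ-δ₀-≡ zero    = refl
  shiftᶜ-δ₀-≡ (suc n) = shiftᶜ-δ₀-≡ n

  shiftᶜ-δ₀-*ʳ : ∀ n c m .{{_ : NonZero m}} → shiftᶜ n δ₀ c ≡ shiftᶜ (n ℕ.* m) δ₀ (c ℕ.* m)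
  shiftᶜ-δ₀-*ʳ n c m with c ℕ.≟ n
  ... | yes refl = trans (shiftᶜ-δ₀-≡ c) (sym (shiftᶜ-δ₀-≡ (c ℕ.* m)))
  ... | no  c≢n  = trans (shiftᶜ-δ₀-≢ n c≢n) (sym (shiftᶜ-δ₀-≢ (n ℕ.* m) (c≢n ∘ ℕ.*-cancelʳ-≡ c n m)))

  shiftᶜ-distrib-+ : ∀ n (f g : Seq) → shiftᶜ n (λ e → f e + g e) ≗ λ e → shiftᶜ n f e + shiftᶜ n g e
  shiftᶜ-distrib-+ zero    f g e       = refl
  shiftᶜ-distrib-+ (suc n) f g zero    = refl
  shiftᶜ-distrib-+ (suc n) f g (suc e) = shiftᶜ-distrib-+ n f g e

  ∑ : ℕ → Seq → ℤ
  ∑ zero    f = + 0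
  ∑ (suc n) f = f 0 + ∑ n (f ∘ suc)

  ∑-cong : ∀ n {f g : Seq} → f ≗ g → ∑ n f ≡ ∑ n g
  ∑-cong zero    f≗g = refl
  ∑-cong (suc n) f≗g = cong₂ _+_ (f≗g 0) (∑-cong n (f≗g ∘ suc))

  ∑-+ : ∀ n (f g : Seq) → ∑ n (λ j → f j + g j) ≡ ∑ n f + ∑ n g
  ∑-+ zero    f g = refl
  ∑-+ (suc n) f g = trans (cong (_+_ (f 0 + g 0)) (∑-+ n (f ∘ suc) (g ∘ suc))) (swap (f 0) (g 0) _ _)
    where
    swap : ∀ a b c d → (a + b) + (c + d) ≡ (a + c) + (b + d)
    swap = solve-∀

  ∑-*ˡ : ∀ n c (f : Seq) → ∑ n (λ j → c * f j) ≡ c * ∑ n f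
  ∑-*ˡ zero    c f = sym (ℤ.*-zeroʳ c)
  ∑-*ˡ (suc n) c f =
    trans (cong (_+_ (c * f 0)) (∑-*ˡ n c (f ∘ suc))) (sym (ℤ.*-distribˡ-+ c (f 0) _))

  ∑-zero : ∀ n → ∑ n (λ _ → + 0) ≡ + 0
  ∑-zero zero    = refl
  ∑-zero (suc n) = trans (ℤ.+-identityˡ _) (∑-zero n)

  ∑-last : ∀ n (f : Seq) → ∑ (suc n) f ≡ ∑ n f + f n
  ∑-last zero    f = trans (ℤ.+-identityʳ (f 0)) (sym (ℤ.+-identityˡ (f 0)))
  ∑-last (suc n) f = trans (cong (_+_ (f 0)) (∑-last n (f ∘ suc))) (sym (ℤ.+-assoc (f 0) _ _))

  shiftᶜ-∑ : ∀ k n (g : ℕ → Seq) →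
             shiftᶜ k (λ e → ∑ n (λ j → g j e)) ≗ λ e → ∑ n (λ j → shiftᶜ k (g j) e)
  shiftᶜ-∑ zero    n g e       = refl
  shiftᶜ-∑ (suc k) n g zero    = sym (∑-zero n)
  shiftᶜ-∑ (suc k) n g (suc e) = shiftᶜ-∑ k n g e

  coeff-⊕ : ∀ P Q → coeff (P ⊕ Q) ≗ λ k → coeff P k + coeff Q k
  coeff-⊕ []       Q        k       = sym (ℤ.+-identityˡ _)
  coeff-⊕ (a ∷ as) []       k       = sym (ℤ.+-identityʳ _)
  coeff-⊕ (a ∷ as) (b ∷ bs) zero    = refl
  coeff-⊕ (a ∷ as) (b ∷ bs) (suc k) = coeff-⊕ as bs k

  coeff-shift : ∀ n P → coeff (shift n P) ≗ shiftᶜ n (coeff P)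
  coeff-shift zero    P k       = refl
  coeff-shift (suc n) P zero    = refl
  coeff-shift (suc n) P (suc k) = coeff-shift n P k

  coeff-derivAux : ∀ i bs k → coeff (derivAux i bs) k ≡ + (i ℕ.+ k) * coeff bs k
  coeff-derivAux i []       k       = sym (ℤ.*-zeroʳ (+ (i ℕ.+ k)))
  coeff-derivAux i (b ∷ bs) zero    = cong (λ j → + j * b) (sym (ℕ.+-identityʳ i))
  coeff-derivAux i (b ∷ bs) (suc k) =
    trans (coeff-derivAux (suc i) bs k) (cong (λ j → + j * coeff bs k) (sym (ℕ.+-suc i k)))

  coeff-deriv : ∀ P k → coeff (deriv P) k ≡ + suc k * coeff P (suc k)
  coeff-deriv []       k = sym (ℤ.*-zeroʳ (+ suc k))
  coeff-deriv (a ∷ as) k = coeff-derivAux 1 as k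

  ∂ : Seq → Seq
  ∂ f e = + suc e * f (suc e)

  E : ℕ → Seq → Seq
  E d f e = ∂ f e + shiftᶜ (d ∸ 1) f e

  L : ℕ → Seq → Seq
  L d f e = f e + E d f e

  coeff-W-zero : ∀ d → coeff (W d 0) ≗ δ₀
  coeff-W-zero d zero    = refl
  coeff-W-zero d (suc e) = refl

  coeff-W-suc : ∀ d m → coeff (W d (suc m)) ≗ L d (coeff (W d m))
  coeff-W-suc d m e = begin
    coeff (deriv Wₘ ⊕ (Wₘ ⊕ shift (d ∸ 1) Wₘ)) e
      ≡⟨ coeff-⊕ (deriv Wₘ) _ e ⟩
    coeff (deriv Wₘ) e + coeff (Wₘ ⊕ shift (d ∸ 1) Wₘ) e
      ≡⟨ cong₂ _+_ (coeff-deriv Wₘ e) (coeff-⊕ Wₘ _ e) ⟩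
    + suc e * w (suc e) + (w e + coeff (shift (d ∸ 1) Wₘ) e)
      ≡⟨ cong (λ z → + suc e * w (suc e) + (w e + z)) (coeff-shift (d ∸ 1) Wₘ e) ⟩
    + suc e * w (suc e) + (w e + shiftᶜ (d ∸ 1) w e)
      ≡⟨ regroup (+ suc e * w (suc e)) (w e) (shiftᶜ (d ∸ 1) w e) ⟩
    L d w e ∎
    where
    open ≡-Reasoning
    Wₘ : Poly
    Wₘ = W d m
    w : Seq
    w = coeff Wₘ
    regroup : ∀ a b c → a + (b + c) ≡ b + (a + c)
    regroup = solve-∀

  ∂-shiftᶜ : ∀ n (f : Seq) e → ∂ (shiftᶜ n f) e ≡ shiftᶜ n (∂ f) e + + n * shiftᶜ n f (suc e)
  ∂-shiftᶜ zero    f e       = sym (trans (cong (_+_ (∂ f e)) (ℤ.*-zeroˡ (f (suc e)))) (ℤ.+-identityʳ (∂ f e)))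
  ∂-shiftᶜ (suc zero)    f zero = sym (ℤ.+-identityˡ _)
  ∂-shiftᶜ (suc (suc n)) f zero = trans (ℤ.*-zeroʳ (+ 1)) (sym (trans (ℤ.+-identityˡ _) (ℤ.*-zeroʳ (+ suc (suc n)))))
  ∂-shiftᶜ (suc n) f (suc e) = begin
    + suc (suc e) * X                      ≡⟨ cong (_* X) (ℤ.pos-+ 1 (suc e)) ⟩
    (+ 1 + + suc e) * X                    ≡⟨ ℤ.*-distribʳ-+ X (+ 1) (+ suc e) ⟩
    + 1 * X + + suc e * X                  ≡⟨ cong (_+_ (+ 1 * X)) (∂-shiftᶜ n f e) ⟩
    + 1 * X + (shiftᶜ n (∂ f) e + + n * X) ≡⟨ regroup X (shiftᶜ n (∂ f) e) (+ n) ⟩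
    shiftᶜ n (∂ f) e + (+ 1 + + n) * X     ≡⟨ cong (λ c → shiftᶜ n (∂ f) e + c * X) (sym (ℤ.pos-+ 1 n)) ⟩
    shiftᶜ n (∂ f) e + + suc n * X         ∎
    where
    open ≡-Reasoning
    X : ℤ
    X = shiftᶜ n f (suc e)
    regroup : ∀ X s ν → + 1 * X + (s + ν * X) ≡ s + (+ 1 + ν) * X
    regroup = solve-∀

  L-shiftᶜ : ∀ d n (f : Seq) e → L d (shiftᶜ n f) e ≡ shiftᶜ n (L d f) e + + n * shiftᶜ n f (suc e)
  L-shiftᶜ d n f e = begin
    shiftᶜ n f e + (∂ (shiftᶜ n f) e + shiftᶜ (d ∸ 1) (shiftᶜ n f) e)
      ≡⟨ cong₂ (λ a b → shiftᶜ n f e + (a + b)) (∂-shiftᶜ n f e) shifts-commute ⟩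
    shiftᶜ n f e + ((shiftᶜ n (∂ f) e + + n * Y) + shiftᶜ n (shiftᶜ (d ∸ 1) f) e)
      ≡⟨ regroup (shiftᶜ n f e) (shiftᶜ n (∂ f) e) (+ n * Y) _ ⟩
    shiftᶜ n f e + (shiftᶜ n (∂ f) e + shiftᶜ n (shiftᶜ (d ∸ 1) f) e) + + n * Y
      ≡⟨ cong (λ z → shiftᶜ n f e + z + + n * Y) (sym (shiftᶜ-distrib-+ n (∂ f) (shiftᶜ (d ∸ 1) f) e)) ⟩
    shiftᶜ n f e + shiftᶜ n (E d f) e + + n * Y
      ≡⟨ cong (_+ + n * Y) (sym (shiftᶜ-distrib-+ n f (E d f) e)) ⟩
    shiftᶜ n (L d f) e + + n * Y ∎
    where
    open ≡-Reasoning
    Y : ℤ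
    Y = shiftᶜ n f (suc e)
    shifts-commute : shiftᶜ (d ∸ 1) (shiftᶜ n f) e ≡ shiftᶜ n (shiftᶜ (d ∸ 1) f) e
    shifts-commute = trans (shiftᶜ-+ (d ∸ 1) n f e)
                           (trans (cong (λ k → shiftᶜ k f e) (ℕ.+-comm (d ∸ 1) n)) (sym (shiftᶜ-+ n (d ∸ 1) f e)))
    regroup : ∀ a b c d → a + ((b + c) + d) ≡ a + (b + d) + c
    regroup = solve-∀

  E-cong : ∀ d {f g : Seq} → f ≗ g → E d f ≗ E d g
  E-cong d f≗g e = cong₂ _+_ (cong (+ suc e *_) (f≗g (suc e))) (shiftᶜ-cong (d ∸ 1) f≗g e)

  E-∑ : ∀ d n (c : ℕ → ℤ) (g : ℕ → Seq) →
        E d (λ x → ∑ n (λ j → c j * g j x)) ≗ λ e → ∑ n (λ j → c j * E d (g j) e)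
  E-∑ d n c g e = begin
    + suc e * ∑ n (λ j → c j * g j (suc e)) + shiftᶜ (d ∸ 1) (λ x → ∑ n (λ j → c j * g j x)) e
      ≡⟨ cong₂ _+_ (sym (∑-*ˡ n (+ suc e) _)) (shiftᶜ-∑ (d ∸ 1) n (λ j x → c j * g j x) e) ⟩
    ∑ n (λ j → + suc e * (c j * g j (suc e))) + ∑ n (λ j → shiftᶜ (d ∸ 1) (λ x → c j * g j x) e)
      ≡⟨ cong (_+_ (∑ n (λ j → + suc e * (c j * g j (suc e)))))
              (∑-cong n (λ j → shiftᶜ-*ˡ (d ∸ 1) (c j) (g j) e)) ⟩
    ∑ n (λ j → + suc e * (c j * g j (suc e))) + ∑ n (λ j → c j * shiftᶜ (d ∸ 1) (g j) e)
      ≡⟨ sym (∑-+ n _ _) ⟩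
    ∑ n (λ j → + suc e * (c j * g j (suc e)) + c j * shiftᶜ (d ∸ 1) (g j) e)
      ≡⟨ ∑-cong n (λ j → factor (+ suc e) (c j) (g j (suc e)) (shiftᶜ (d ∸ 1) (g j) e)) ⟩
    ∑ n (λ j → c j * E d (g j) e) ∎
    where
    open ≡-Reasoning
    factor : ∀ s c a b → s * (c * a) + c * b ≡ c * (s * a + b)
    factor = solve-∀

  V : ℕ → ℕ → Seq
  V d zero    = δ₀
  V d (suc m) = E d (V d m)

  coeff-W-binomial : ∀ d m → coeff (W d m) ≗ λ e → ∑ (suc m) (λ j → + (m C j) * V d j e)
  coeff-W-binomial d zero    zero    = refl
  coeff-W-binomial d zero    (suc e) = refl
  coeff-W-binomial d (suc m) e = begin
    coeff (W d (suc m)) e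
      ≡⟨ coeff-W-suc d m e ⟩
    coeff (W d m) e + E d (coeff (W d m)) e
      ≡⟨ cong₂ _+_ (coeff-W-binomial d m e) (E-cong d (coeff-W-binomial d m) e) ⟩
    S e + E d S e
      ≡⟨ cong (_+_ (S e)) (E-∑ d (suc m) (λ j → + (m C j)) (V d) e) ⟩
    (+ 1 * V d 0 e + ∑ m (λ j → + (m C suc j) * V d (suc j) e)) + A
      ≡⟨ cong (λ z → (+ 1 * V d 0 e + z) + A) (sym B-last) ⟩
    (+ 1 * V d 0 e + B) + A
      ≡⟨ regroup (+ 1 * V d 0 e) B A ⟩
    + 1 * V d 0 e + (A + B)
      ≡⟨ cong (_+_ (+ 1 * V d 0 e)) (sym (trans (∑-cong (suc m) pascal)
                                              (∑-+ (suc m) (λ j → + (m C j) * V d (suc j) e)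
                                                           (λ j → + (m C suc j) * V d (suc j) e)))) ⟩
    ∑ (suc (suc m)) (λ j → + (suc m C j) * V d j e) ∎
    where
    open ≡-Reasoning
    S : Seq
    S x = ∑ (suc m) (λ j → + (m C j) * V d j x)
    A B : ℤ
    A = ∑ (suc m) (λ j → + (m C j) * V d (suc j) e)
    B = ∑ (suc m) (λ j → + (m C suc j) * V d (suc j) e)
    B-last : B ≡ ∑ m (λ j → + (m C suc j) * V d (suc j) e)
    B-last = begin
      B                                                          ≡⟨ ∑-last m _ ⟩
      ∑ m (λ j → + (m C suc j) * V d (suc j) e) + + (m C suc m) * V d (suc m) e
        ≡⟨ cong (λ c → ∑ m (λ j → + (m C suc j) * V d (suc j) e) + + c * V d (suc m) e) (k>n⇒nCk≡0 (ℕ.n<1+n m)) ⟩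
      ∑ m (λ j → + (m C suc j) * V d (suc j) e) + + 0 * V d (suc m) e
        ≡⟨ ℤ.+-identityʳ _ ⟩
      ∑ m (λ j → + (m C suc j) * V d (suc j) e) ∎
    pascal : ∀ j → + (suc m C suc j) * V d (suc j) e ≡ + (m C j) * V d (suc j) e + + (m C suc j) * V d (suc j) e
    pascal j = trans (cong (λ c → + c * V d (suc j) e) (sym (nCk+nC[k+1]≡[n+1]C[k+1] m j)))
                     (trans (cong (_* V d (suc j) e) (ℤ.pos-+ (m C j) (m C suc j)))
                            (ℤ.*-distribʳ-+ (V d (suc j) e) (+ (m C j)) (+ (m C suc j))))
    regroup : ∀ v b a → (v + b) + a ≡ v + (a + b)
    regroup = solve-∀

  falling : ℕ → Seq
  falling zero    = δ₀
  falling (suc m) j = shiftᶜ 1 (falling m) j - + m * falling m j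

  falling-> : ∀ m {j} → m < j → falling m j ≡ + 0
  falling-> zero    {suc j} _ = refl
  falling-> (suc m) {suc j} (s≤s m<j)
    rewrite falling-> m m<j | falling-> m (ℕ.m<n⇒m<1+n m<j) | ℤ.*-zeroʳ (+ m) = refl

  falling-top : ∀ m → falling m m ≡ + 1
  falling-top zero    = refl
  falling-top (suc m) rewrite falling-top m | falling-> m (ℕ.n<1+n m) | ℤ.*-zeroʳ (+ m) = refl

  falling-zero : ∀ m → falling (suc m) 0 ≡ + 0
  falling-zero zero    = refl
  falling-zero (suc m) rewrite falling-zero m | ℤ.*-zeroʳ (+ suc m) = refl

  -- The coefficients of a(y + 1), for a vanishing from index n on.
  translate : ℕ → Seq → Seq
  translate n a k = ∑ n (λ j → + (j C k) * a j)

  translate-vanishing : ∀ n (a : Seq) → a n ≡ + 0 → translate (suc n) a ≗ translate n a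
  translate-vanishing n a aₙ≡0 k = begin
    translate (suc n) a k           ≡⟨ ∑-last n _ ⟩
    translate n a k + + (n C k) * a n ≡⟨ cong (λ x → translate n a k + + (n C k) * x) aₙ≡0 ⟩
    translate n a k + + (n C k) * + 0 ≡⟨ cong (_+_ (translate n a k)) (ℤ.*-zeroʳ (+ (n C k))) ⟩
    translate n a k + + 0           ≡⟨ ℤ.+-identityʳ _ ⟩
    translate n a k                 ∎
    where open ≡-Reasoning

  translate-shiftᶜ : ∀ n (a : Seq) → translate (suc n) (shiftᶜ 1 a) ≗ λ k → translate n a k + shiftᶜ 1 (translate n a) k
  translate-shiftᶜ n a k = begin
    + (0 C k) * + 0 + ∑ n (λ j → + (suc j C k) * a j)
      ≡⟨ cong₂ _+_ (ℤ.*-zeroʳ (+ (0 C k))) (∑-cong n (λ j → cong (_* a j) (pascal j k))) ⟩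
    + 0 + ∑ n (λ j → (binom j k + shiftᶜ 1 (binom j) k) * a j)
      ≡⟨ trans (ℤ.+-identityˡ _) (∑-cong n (λ j → ℤ.*-distribʳ-+ (a j) (binom j k) (shiftᶜ 1 (binom j) k))) ⟩
    ∑ n (λ j → binom j k * a j + shiftᶜ 1 (binom j) k * a j)
      ≡⟨ ∑-+ n (λ j → binom j k * a j) (λ j → shiftᶜ 1 (binom j) k * a j) ⟩
    translate n a k + ∑ n (λ j → shiftᶜ 1 (binom j) k * a j)
      ≡⟨ cong (_+_ (translate n a k)) (lower k) ⟩
    translate n a k + shiftᶜ 1 (translate n a) k ∎
    where
    open ≡-Reasoning
    binom : ℕ → Seq
    binom j i = + (j C i)
    pascal : ∀ j k → + (suc j C k) ≡ binom j k + shiftᶜ 1 (binom j) k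
    pascal j zero    = refl
    pascal j (suc k) = trans (cong +_ (sym (nCk+nC[k+1]≡[n+1]C[k+1] j k)))
                             (trans (ℤ.pos-+ (j C k) (j C suc k)) (ℤ.+-comm (binom j k) (binom j (suc k))))
    lower : ∀ k → ∑ n (λ j → shiftᶜ 1 (binom j) k * a j) ≡ shiftᶜ 1 (translate n a) k
    lower zero    = trans (∑-cong n (λ j → ℤ.*-zeroˡ (a j))) (∑-zero n)
    lower (suc k) = refl

  translate-falling : ∀ m → translate (2 ℕ.+ m) (falling (suc m)) ≗ λ k → falling m k + shiftᶜ 1 (falling m) k
  translate-falling zero zero                = refl
  translate-falling zero (suc zero)          = refl
  translate-falling zero (suc (suc k))       = refl
  translate-falling (suc m) k = begin
    translate (3 ℕ.+ m) (falling (2 ℕ.+ m)) k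
      ≡⟨ ∑-cong (3 ℕ.+ m) (λ j → expand (+ (j C k)) (shiftᶜ 1 F j) (+ suc m) (F j)) ⟩
    ∑ (3 ℕ.+ m) (λ j → + (j C k) * shiftᶜ 1 F j + - + suc m * (+ (j C k) * F j))
      ≡⟨ ∑-+ (3 ℕ.+ m) (λ j → + (j C k) * shiftᶜ 1 F j) (λ j → - + suc m * (+ (j C k) * F j)) ⟩
    translate (3 ℕ.+ m) (shiftᶜ 1 F) k + ∑ (3 ℕ.+ m) (λ j → - + suc m * (+ (j C k) * F j))
      ≡⟨ cong₂ _+_ (translate-shiftᶜ (2 ℕ.+ m) F k) (∑-*ˡ (3 ℕ.+ m) (- + suc m) (λ j → + (j C k) * F j)) ⟩
    T k + shiftᶜ 1 T k + - + suc m * translate (3 ℕ.+ m) F k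
      ≡⟨ cong (λ x → T k + shiftᶜ 1 T k + - + suc m * x)
              (translate-vanishing (2 ℕ.+ m) F (falling-> (suc m) (ℕ.n<1+n (suc m))) k) ⟩
    T k + shiftᶜ 1 T k + - + suc m * T k
      ≡⟨ product k ⟩
    falling (suc m) k + shiftᶜ 1 (falling (suc m)) k ∎
    where
    open ≡-Reasoning
    F T : Seq
    F = falling (suc m)
    T = translate (2 ℕ.+ m) F
    expand : ∀ c s μ f → c * (s - μ * f) ≡ c * s + - μ * (c * f)
    expand = solve-∀
    product : ∀ k → T k + shiftᶜ 1 T k + - + suc m * T k ≡ falling (suc m) k + shiftᶜ 1 (falling (suc m)) k
    product zero    rewrite translate-falling m 0 | ℤ.pos-+ 1 m = ring (falling m 0) (+ m)
      where
      ring : ∀ x μ → (x + + 0) + + 0 + - (+ 1 + μ) * (x + + 0) ≡ (+ 0 - μ * x) + + 0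
      ring = solve-∀
    product (suc k) rewrite translate-falling m (suc k) | translate-falling m k | ℤ.pos-+ 1 m =
      ring (falling m (suc k)) (falling m k) (shiftᶜ 1 (falling m) k) (+ m)
      where
      ring : ∀ x y z μ → ((x + y) + (y + z)) + - (+ 1 + μ) * (x + y) ≡ (y - μ * x) + (z - μ * y)
      ring = solve-∀

  module Modulo (n : ℕ) where

    open import Data.Integer.Divisibility.Signed
      using (_∣_; divides; ∣m∣n⇒∣m+n; ∣m⇒∣-m; ∣n⇒∣m*n; ∣⇒∣ᵤ)
    open import Relation.Binary.Bundles using (Setoid)
    import Data.Nat.Divisibility as ℕ∣ using (_∣_; divides)

    infix 4 _≈_ _≋_

    record _≈_ (a b : ℤ) : Set where
      constructor mkCong
      field n∣a-b : + n ∣ a - b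

    open _≈_ public

    _≋_ : Seq → Seq → Set
    f ≋ g = ∀ e → f e ≈ g e

    ≈-by-multiple : ∀ {a b} k → a ≡ b + k * + n → a ≈ b
    ≈-by-multiple {a} {b} k a≡b+kn = mkCong (divides k (trans (cong (_- b) a≡b+kn) (cancel b (k * + n))))
      where
      cancel : ∀ b x → (b + x) - b ≡ x
      cancel = solve-∀

    ≈-reflexive : ∀ {a b} → a ≡ b → a ≈ b
    ≈-reflexive {a} refl = ≈-by-multiple (+ 0) (sym (ℤ.+-identityʳ a))

    ≈-refl : ∀ {a} → a ≈ a
    ≈-refl = ≈-reflexive refl

    ≈-sym : ∀ {a b} → a ≈ b → b ≈ a
    ≈-sym {a} {b} (mkCong n∣a-b) = mkCong (subst (+ n ∣_) (negate a b) (∣m⇒∣-m n∣a-b))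
      where
      negate : ∀ a b → - (a - b) ≡ b - a
      negate = solve-∀

    ≈-trans : ∀ {a b c} → a ≈ b → b ≈ c → a ≈ c
    ≈-trans {a} {b} {c} (mkCong n∣a-b) (mkCong n∣b-c) =
      mkCong (subst (+ n ∣_) (telescope a b c) (∣m∣n⇒∣m+n n∣a-b n∣b-c))
      where
      telescope : ∀ a b c → (a - b) + (b - c) ≡ a - c
      telescope = solve-∀

    ≈-setoid : Setoid _ _
    ≈-setoid = record
      { Carrier = ℤ ; _≈_ = _≈_
      ; isEquivalence = record { refl = ≈-refl ; sym = ≈-sym ; trans = ≈-trans } }

    +-cong : ∀ {a b c d} → a ≈ b → c ≈ d → a + c ≈ b + d
    +-cong {a} {b} {c} {d} (mkCong n∣a-b) (mkCong n∣c-d) =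
      mkCong (subst (+ n ∣_) (regroup a b c d) (∣m∣n⇒∣m+n n∣a-b n∣c-d))
      where
      regroup : ∀ a b c d → (a - b) + (c - d) ≡ (a + c) - (b + d)
      regroup = solve-∀

    *-congˡ : ∀ k {a b} → a ≈ b → k * a ≈ k * b
    *-congˡ k {a} {b} (mkCong n∣a-b) = mkCong (subst (+ n ∣_) (distrib k a b) (∣n⇒∣m*n k n∣a-b))
      where
      distrib : ∀ k a b → k * (a - b) ≡ k * a - k * b
      distrib = solve-∀

    *-congʳ : ∀ k {a b} → a ≈ b → a * k ≈ b * k
    *-congʳ k {a} {b} a≈b = subst₂ _≈_ (ℤ.*-comm k a) (ℤ.*-comm k b) (*-congˡ k a≈b)

    +-cancelˡ : ∀ {a x} → a + x ≈ a → x ≈ + 0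
    +-cancelˡ {a} {x} a+x≈a = subst₂ _≈_ (cancel a x) (ℤ.+-inverseˡ a) (+-cong (≈-refl { - a}) a+x≈a)
      where
      cancel : ∀ a x → - a + (a + x) ≡ x
      cancel = solve-∀

    ∣⇒≈0 : ∀ {x} → n ℕ∣.∣ x → + x ≈ + 0
    ∣⇒≈0 (ℕ∣.divides c x≡cn) =
      ≈-by-multiple (+ c) (trans (cong +_ x≡cn) (trans (ℤ.pos-* c n) (sym (ℤ.+-identityˡ _))))

    shiftᶜ-cong≈ : ∀ k {f g : Seq} → f ≋ g → shiftᶜ k f ≋ shiftᶜ k g
    shiftᶜ-cong≈ zero    f≋g e       = f≋g e
    shiftᶜ-cong≈ (suc k) f≋g zero    = ≈-refl
    shiftᶜ-cong≈ (suc k) f≋g (suc e) = shiftᶜ-cong≈ k f≋g e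

    ∑-cong≈ : ∀ m {f g : Seq} → (∀ j → j < m → f j ≈ g j) → ∑ m f ≈ ∑ m g
    ∑-cong≈ zero    f≈g = ≈-refl
    ∑-cong≈ (suc m) f≈g = +-cong (f≈g 0 (s≤s z≤n)) (∑-cong≈ m (λ j j<m → f≈g (suc j) (s≤s j<m)))

    ∑-≈0 : ∀ m {f : Seq} → (∀ j → j < m → f j ≈ + 0) → ∑ m f ≈ + 0
    ∑-≈0 m f≈0 = ≈-trans (∑-cong≈ m f≈0) (≈-reflexive (∑-zero m))

    ∑-single : ∀ m a {f : Seq} → a < m → (∀ j → j < m → j ≢ a → f j ≈ + 0) → ∑ m f ≈ f a
    ∑-single (suc m) zero    {f} _         others =
      ≈-trans (+-cong (≈-refl {f 0}) (∑-≈0 m (λ j j<m → others (suc j) (s≤s j<m) λ ())))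
              (≈-reflexive (ℤ.+-identityʳ (f 0)))
    ∑-single (suc m) (suc a) {f} (s≤s a<m) others =
      ≈-trans (+-cong (others 0 (s≤s z≤n) λ ())
                      (∑-single m a a<m (λ j j<m j≢a → others (suc j) (s≤s j<m) (j≢a ∘ ℕ.suc-injective))))
              (≈-reflexive (ℤ.+-identityˡ (f (suc a))))

    ∑-pair : ∀ m a b {f : Seq} → a < b → b < m →
             (∀ j → j < m → j ≢ a → j ≢ b → f j ≈ + 0) → ∑ m f ≈ f a + f b
    ∑-pair (suc m) zero    (suc b) {f} _         (s≤s b<m) others =
      +-cong (≈-refl {f 0})
             (∑-single m b b<m (λ j j<m j≢b → others (suc j) (s≤s j<m) (λ ()) (j≢b ∘ ℕ.suc-injective)))
    ∑-pair (suc m) (suc a) (suc b) {f} (s≤s a<b) (s≤s b<m) others =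
      ≈-trans (+-cong (others 0 (s≤s z≤n) (λ ()) (λ ()))
                      (∑-pair m a b a<b b<m (λ j j<m j≢a j≢b →
                        others (suc j) (s≤s j<m) (j≢a ∘ ℕ.suc-injective) (j≢b ∘ ℕ.suc-injective))))
              (≈-reflexive (ℤ.+-identityˡ _))

    ≋-shift⇒≡[mod] : ∀ P s Q → coeff P ≋ shiftᶜ s (coeff Q) → P ≡[mod n ] shift s Q
    ≋-shift⇒≡[mod] P s Q P≋xˢQ k =
      ∣⇒∣ᵤ (n∣a-b (≈-trans (P≋xˢQ k) (≈-reflexive (sym (coeff-shift s Q k)))))

  module Graded (q : ℕ) where

    open import Data.Nat.Divisibility using (_∣_; divides; ∣m∣n⇒∣m+n; ∣-refl)
    open import Relation.Nullary using (¬_; yes; no)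
    open import Data.Sum using (inj₁; inj₂)

    p : ℕ
    p = suc q

    -- V p m is supported on the degrees e with p ∣ e + m, and T m j is its
    -- coefficient in degree j p - m: V p m = x^(-m) T_m(x^p).
    T : ℕ → Seq
    T zero    = δ₀
    T (suc m) j = (+ (j ℕ.* p) - + m) * T m j + shiftᶜ 1 (T m) j

    T-vanishing : ∀ m {j} → j ℕ.* p < m → T m j ≡ + 0
    T-vanishing (suc m) {j} jp<1+m = cong₂ _+_ first (second j jp<1+m)
      where
      first : (+ (j ℕ.* p) - + m) * T m j ≡ + 0
      first with ℕ.m≤n⇒m<n∨m≡n (ℕ.≤-pred jp<1+m)
      ... | inj₁ jp<m = trans (cong ((+ (j ℕ.* p) - + m) *_) (T-vanishing m jp<m)) (ℤ.*-zeroʳ (+ (j ℕ.* p) - + m))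
      ... | inj₂ jp≡m = cong (_* T m j) (trans (cong (λ x → + x - + m) jp≡m) (ℤ.+-inverseʳ (+ m)))
      second : ∀ j → j ℕ.* p < suc m → shiftᶜ 1 (T m) j ≡ + 0
      second zero     _      = refl
      second (suc j′) jp<1+m = T-vanishing m (ℕ.<-≤-trans (ℕ.m<n+m (j′ ℕ.* p) (s≤s z≤n)) (ℕ.≤-pred jp<1+m))

    private
      shift-back : ∀ {e} m → q ≤ e → (e ∸ q) ℕ.+ m ℕ.+ p ≡ e ℕ.+ suc m
      shift-back {e} m q≤e =
        trans (ring (e ∸ q) m q) (cong (ℕ._+ suc m) (ℕ.m∸n+n≡m q≤e))
        where
        open import Data.Nat.Tactic.RingSolver using () renaming (solve-∀ to solveℕ-∀)
        ring : ∀ x m q → x ℕ.+ m ℕ.+ suc q ≡ (x ℕ.+ q) ℕ.+ suc m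
        ring = solveℕ-∀

    V-ungraded : ∀ m {e} → ¬ p ∣ e ℕ.+ m → V p m e ≡ + 0
    V-ungraded zero    {zero}  p∤e = contradiction (divides 0 refl) p∤e
    V-ungraded zero    {suc e} _   = refl
    V-ungraded (suc m) {e}     p∤e+1+m = cong₂ _+_ first second
      where
      first : + suc e * V p m (suc e) ≡ + 0
      first = trans (cong (+ suc e *_) (V-ungraded m (p∤e+1+m ∘ subst (p ∣_) (sym (ℕ.+-suc e m)))))
                    (ℤ.*-zeroʳ (+ suc e))
      second : shiftᶜ q (V p m) e ≡ + 0
      second with q ℕ.≤? e
      ... | no  q≰e = shiftᶜ-< q (V p m) (ℕ.≰⇒> q≰e)
      ... | yes q≤e = trans (shiftᶜ-≥ q (V p m) q≤e) (V-ungraded m λ p∣ →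
                        p∤e+1+m (subst (p ∣_) (shift-back m q≤e) (∣m∣n⇒∣m+n p∣ ∣-refl)))

    V-graded : ∀ m {e} j → e ℕ.+ m ≡ j ℕ.* p → V p m e ≡ T m j
    V-graded zero    {zero}  zero    _  = refl
    V-graded zero    {suc e} (suc j) _  = refl
    V-graded (suc m) {e}     j       e+1+m≡jp = cong₂ _+_ first (second j e+1+m≡jp)
      where
      1+e+m≡jp : suc e ℕ.+ m ≡ j ℕ.* p
      1+e+m≡jp = trans (sym (ℕ.+-suc e m)) e+1+m≡jp
      first : + suc e * V p m (suc e) ≡ (+ (j ℕ.* p) - + m) * T m j
      first = cong₂ _*_ (sym (trans (cong (λ x → + x - + m) (sym 1+e+m≡jp))
                                    (trans (cong (_- + m) (ℤ.pos-+ (suc e) m)) (cancel (+ suc e) (+ m)))))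
                        (V-graded m j 1+e+m≡jp)
        where
        cancel : ∀ a b → (a + b) - b ≡ a
        cancel = solve-∀
      second : ∀ j → e ℕ.+ suc m ≡ j ℕ.* p → shiftᶜ q (V p m) e ≡ shiftᶜ 1 (T m) j
      second zero     e+1+m≡0 = contradiction (trans (sym (ℕ.+-suc e m)) e+1+m≡0) λ ()
      second (suc j′) e+1+m≡jp with q ℕ.≤? e
      ... | yes q≤e = trans (shiftᶜ-≥ q (V p m) q≤e)
                            (V-graded m j′ (ℕ.+-cancelʳ-≡ p _ _
                              (trans (shift-back m q≤e) (trans e+1+m≡jp (ℕ.+-comm p (j′ ℕ.* p))))))
      ... | no  q≰e = trans (shiftᶜ-< q (V p m) (ℕ.≰⇒> q≰e))
                            (sym (T-vanishing m (ℕ.+-cancelˡ-< p (j′ ℕ.* p) m p+j′p<p+m)))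
        where
        open ℕ.≤-Reasoning
        p+j′p<p+m : p ℕ.+ j′ ℕ.* p < p ℕ.+ m
        p+j′p<p+m = begin-strict
          p ℕ.+ j′ ℕ.* p  ≡⟨ e+1+m≡jp ⟨
          e ℕ.+ suc m     <⟨ ℕ.+-monoˡ-< (suc m) (ℕ.≰⇒> q≰e) ⟩
          q ℕ.+ suc m     ≡⟨ ℕ.+-suc q m ⟩
          p ℕ.+ m         ∎

    open Modulo p

    T≋falling : ∀ m → T m ≋ falling m
    T≋falling zero    j = ≈-refl
    T≋falling (suc m) j = ≈-trans
      (+-cong (≈-trans (*-congʳ (T m j) jp-m≈-m) (*-congˡ (- + m) (T≋falling m j))) (shiftᶜ-cong≈ 1 (T≋falling m) j))
      (≈-reflexive (reorder (+ m) (falling m j) (shiftᶜ 1 (falling m) j)))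
      where
      jp-m≈-m : + (j ℕ.* p) - + m ≈ - + m
      jp-m≈-m = ≈-by-multiple (+ j) (trans (cong (_- + m) (ℤ.pos-* j p)) (ℤ.+-comm (+ j * + p) (- + m)))
      reorder : ∀ μ f s → - μ * f + s ≡ s - μ * f
      reorder = solve-∀

  module AtPrime (r : ℕ) (p-prime : Prime (2 ℕ.+ r)) where

    open import Data.Nat.Coprimality using (prime⇒coprime; coprime-divisor)
    open import Data.Nat.Divisibility using (_∣_; divides; _∣?_; ∣m+n∣m⇒∣n; ∣-refl; m∣m*n; _∣0)
    import Data.Integer.Coprimality as ℤᶜ using (coprime-divisor)
    open import Data.Integer.Divisibility.Signed using (∣ᵤ⇒∣; ∣⇒∣ᵤ) renaming (_∣_ to _∣ₛ_)
    open import Data.Sum using (inj₁; inj₂)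
    open import Relation.Binary.Definitions using (tri<; tri≈; tri>)
    open import Relation.Nullary using (¬_)

    open Graded (suc r)
    open Modulo p

    q N : ℕ
    q = suc r
    N = p ℕ.* q

    pCk≈0 : ∀ {k} → 0 < k → k < p → + (p C k) ≈ + 0
    pCk≈0 {suc k} _ 1+k<p = ∣⇒≈0 (coprime-divisor (prime⇒coprime p-prime 1+k<p) (divides (q C k) absorb))
      where
      absorb : suc k ℕ.* (p C suc k) ≡ (q C k) ℕ.* p
      absorb = trans ([1+k]*[1+n]C[1+k]≡[1+n]*nCk q k) (ℕ.*-comm p (q C k))

    *-cancelˡ-≈0 : ∀ {i x} → 0 < i → i < p → + i * x ≈ + 0 → x ≈ + 0
    *-cancelˡ-≈0 {suc i} {x} _ i<p (mkCong p∣ix) =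
      mkCong (subst (+ p ∣ₛ_) (sym (ℤ.+-identityʳ x))
        (∣ᵤ⇒∣ (ℤᶜ.coprime-divisor (+ p) (+ suc i) x (prime⇒coprime p-prime i<p)
          (∣⇒∣ᵤ (subst (+ p ∣ₛ_) (ℤ.+-identityʳ (+ suc i * x)) p∣ix)))))

    translate-falling-prime : translate (suc p) (falling p) ≋ falling p
    translate-falling-prime k = ≈-by-multiple (falling q k) (trans (translate-falling q k)
      (trans (ring (falling q k) (shiftᶜ 1 (falling q) k) (+ q))
             (cong (λ c → falling p k + falling q k * c) (sym (ℤ.pos-+ 1 q)))))
      where
      ring : ∀ a b κ → a + b ≡ (b - κ * a) + a * (+ 1 + κ)
      ring = solve-∀

    falling-prime-middle : ∀ k → 2 ≤ k → k ≤ q → falling p k ≈ + 0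
    falling-prime-middle k 2≤k k≤q = downward-induction (λ k → 2 ≤ k → falling p k ≈ + 0) q step k k≤q 2≤k
      where
      step : ∀ k → k ≤ q → (∀ j → k < j → j ≤ q → 2 ≤ j → falling p j ≈ + 0) → 2 ≤ k → falling p k ≈ + 0
      step (suc k) k<q above (s≤s 1≤k) = *-cancelˡ-≈0 (s≤s z≤n) (s≤s k<q) (+-cancelˡ (begin
        falling p k + + suc k * falling p (suc k)
          ≡⟨ cong (_+ + suc k * falling p (suc k)) (sym (ℤ.*-identityˡ (falling p k))) ⟩
        + 1 * falling p k + + suc k * falling p (suc k)
          ≡⟨ cong₂ (λ a b → + a * falling p k + + b * falling p (suc k)) (sym (nCn≡1 k)) (sym ([1+n]Cn≡1+n k)) ⟩
        f k + f (suc k)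
          ≈⟨ ≈-sym (∑-pair (suc p) k (suc k) ℕ.≤-refl (s≤s (ℕ.m≤n⇒m≤1+n k<q)) others) ⟩
        translate (suc p) (falling p) k
          ≈⟨ translate-falling-prime k ⟩
        falling p k ∎))
        where
        open import Relation.Binary.Reasoning.Setoid ≈-setoid
        f : Seq
        f j = + (j C k) * falling p j
        others : ∀ j → j < suc p → j ≢ k → j ≢ suc k → f j ≈ + 0
        others j j<1+p j≢k j≢1+k with ℕ.<-cmp j k
        ... | tri< j<k _ _ = ≈-reflexive (trans (cong (λ c → + c * falling p j) (k>n⇒nCk≡0 j<k)) (ℤ.*-zeroˡ (falling p j)))
        ... | tri≈ _ j≡k _ = contradiction j≡k j≢k
        ... | tri> _ _ k<j with ℕ.m≤n⇒m<n∨m≡n (ℕ.≤-pred j<1+p)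
        ...   | inj₁ j<p  = ≈-trans (*-congˡ (+ (j C k)) (above j (ℕ.≤∧≢⇒< k<j (j≢1+k ∘ sym)) (ℕ.≤-pred j<p)
                                      (ℕ.≤-trans (s≤s (s≤s z≤n)) (ℕ.≤-trans (s≤s 1≤k) k<j))))
                                    (≈-reflexive (ℤ.*-zeroʳ (+ (j C k))))
        ...   | inj₂ refl = ≈-trans (*-congʳ (falling p p) (pCk≈0 1≤k (ℕ.m<n⇒m<1+n k<q)))
                                    (≈-reflexive (ℤ.*-zeroˡ (falling p p)))

    falling-prime-one : falling p 1 ≈ - + 1
    falling-prime-one = begin
      falling p 1                          ≡⟨ sym (cancel (falling p 1)) ⟩
      (+ 1 * falling p 1 + + 1) + - + 1
        ≡⟨ cong (λ c → (+ 1 * falling p 1 + c) + - + 1) (sym (trans (ℤ.*-identityˡ _) (falling-top p))) ⟩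
      (+ 1 * falling p 1 + + 1 * falling p p) + - + 1
        ≈⟨ +-cong (≈-sym (∑-pair (suc p) 1 p (s≤s (s≤s z≤n)) ℕ.≤-refl others)) ≈-refl ⟩
      translate (suc p) (falling p) 0 + - + 1
        ≈⟨ +-cong (translate-falling-prime 0) ≈-refl ⟩
      falling p 0 + - + 1                 ≡⟨ cong (_+ - + 1) (falling-zero q) ⟩
      + 0 + - + 1                         ≡⟨⟩
      - + 1 ∎
      where
      open import Relation.Binary.Reasoning.Setoid ≈-setoid
      cancel : ∀ a → (+ 1 * a + + 1) + - + 1 ≡ a
      cancel = solve-∀
      others : ∀ j → j < suc p → j ≢ 1 → j ≢ p → + (j C 0) * falling p j ≈ + 0
      others zero          _       _ _   = ≈-reflexive (cong (+ 1 *_) (falling-zero q))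
      others (suc zero)    _       j≢1 _ = contradiction refl j≢1
      others (suc (suc j)) j<1+p   _ j≢p = *-congˡ (+ 1) (falling-prime-middle (suc (suc j)) (s≤s (s≤s z≤n))
                                             (ℕ.≤-pred (ℕ.≤∧≢⇒< (ℕ.≤-pred j<1+p) j≢p)))

    falling-prime : falling p ≋ λ j → shiftᶜ p δ₀ j - shiftᶜ 1 δ₀ j
    falling-prime zero          = ≈-reflexive (falling-zero q)
    falling-prime (suc zero)    = falling-prime-one
    falling-prime (suc (suc j)) with ℕ.<-cmp (suc (suc j)) p
    ... | tri< j<p _ _ = ≈-trans (falling-prime-middle (suc (suc j)) (s≤s (s≤s z≤n)) (ℕ.≤-pred j<p))
                                 (≈-reflexive (sym (cong (_- + 0) (shiftᶜ-δ₀-≢ p (ℕ.<⇒≢ j<p)))))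
    ... | tri≈ _ refl _ = ≈-reflexive (trans (falling-top p) (sym (cong (_- + 0) (shiftᶜ-δ₀-≡ p))))
    ... | tri> _ _ p<j = ≈-reflexive (trans (falling-> p p<j) (sym (cong (_- + 0) (shiftᶜ-δ₀-≢ p (ℕ.>⇒≢ p<j)))))

    V-prime : V p p ≋ λ e → shiftᶜ N δ₀ e - δ₀ e
    V-prime e with p ∣? e
    ... | no p∤e =
      ≈-reflexive (trans (V-ungraded p p∤e+p) (sym (cong₂ _-_ (shiftᶜ-δ₀-≢ N e≢N) (shiftᶜ-δ₀-≢ 0 e≢0))))
      where
      p∤e+p : ¬ p ∣ e ℕ.+ p
      p∤e+p p∣e+p = p∤e (∣m+n∣m⇒∣n (subst (p ∣_) (ℕ.+-comm e p) p∣e+p) ∣-refl)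
      e≢N : e ≢ N
      e≢N e≡N = p∤e (subst (p ∣_) (sym e≡N) (m∣m*n q))
      e≢0 : e ≢ 0
      e≢0 e≡0 = p∤e (subst (p ∣_) (sym e≡0) (p ∣0))
    ... | yes (divides c refl) = begin
      V p p (c ℕ.* p)                          ≡⟨ V-graded p (suc c) (ℕ.+-comm (c ℕ.* p) p) ⟩
      T p (suc c)                              ≈⟨ T≋falling p (suc c) ⟩
      falling p (suc c)                        ≈⟨ falling-prime (suc c) ⟩
      shiftᶜ q δ₀ c - δ₀ c                     ≡⟨ cong₂ _-_ (shiftᶜ-δ₀-*ʳ q c p) (shiftᶜ-δ₀-*ʳ 0 c p) ⟩
      shiftᶜ (q ℕ.* p) δ₀ (c ℕ.* p) - δ₀ (c ℕ.* p)
        ≡⟨ cong (λ n → shiftᶜ n δ₀ (c ℕ.* p) - δ₀ (c ℕ.* p)) (ℕ.*-comm q p) ⟩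
      shiftᶜ N δ₀ (c ℕ.* p) - δ₀ (c ℕ.* p)     ∎
      where open import Relation.Binary.Reasoning.Setoid ≈-setoid

    W-prime : coeff (W p p) ≋ shiftᶜ N δ₀
    W-prime e = begin
      coeff (W p p) e
        ≡⟨ coeff-W-binomial p p e ⟩
      ∑ (suc p) (λ j → + (p C j) * V p j e)
        ≈⟨ ∑-pair (suc p) 0 p (s≤s z≤n) ℕ.≤-refl others ⟩
      + 1 * δ₀ e + + (p C p) * V p p e
        ≡⟨ cong₂ _+_ (ℤ.*-identityˡ (δ₀ e))
                     (trans (cong (λ c → + c * V p p e) (nCn≡1 p)) (ℤ.*-identityˡ (V p p e))) ⟩
      δ₀ e + V p p e
        ≈⟨ +-cong (≈-refl {δ₀ e}) (V-prime e) ⟩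
      δ₀ e + (shiftᶜ N δ₀ e - δ₀ e)
        ≡⟨ cancel (δ₀ e) (shiftᶜ N δ₀ e) ⟩
      shiftᶜ N δ₀ e ∎
      where
      open import Relation.Binary.Reasoning.Setoid ≈-setoid
      cancel : ∀ a b → a + (b - a) ≡ b
      cancel = solve-∀
      others : ∀ j → j < suc p → j ≢ 0 → j ≢ p → + (p C j) * V p j e ≈ + 0
      others zero    _     j≢0 _   = contradiction refl j≢0
      others (suc j) j<1+p _   j≢p =
        ≈-trans (*-congʳ (V p (suc j) e) (pCk≈0 (s≤s z≤n) (ℕ.≤∧≢⇒< (ℕ.≤-pred j<1+p) j≢p)))
                (≈-reflexive (ℤ.*-zeroˡ (V p (suc j) e)))

    L-cong≈ : ∀ d {f g : Seq} → f ≋ g → L d f ≋ L d g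
    L-cong≈ d f≋g e = +-cong (f≋g e) (+-cong (*-congˡ (+ suc e) (f≋g (suc e))) (shiftᶜ-cong≈ (d ∸ 1) f≋g e))

    L-shiftᶜ-N : ∀ (f : Seq) → L p (shiftᶜ N f) ≋ shiftᶜ N (L p f)
    L-shiftᶜ-N f e = ≈-by-multiple (+ q * shiftᶜ N f (suc e))
      (trans (L-shiftᶜ p N f e) (cong (_+_ (shiftᶜ N (L p f) e))
        (trans (cong (_* shiftᶜ N f (suc e)) (ℤ.pos-* p q)) (rearrange (+ p) (+ q) _))))
      where
      rearrange : ∀ a b c → a * b * c ≡ b * c * a
      rearrange = solve-∀

    W-period : ∀ m → coeff (W p (m ℕ.+ p)) ≋ shiftᶜ N (coeff (W p m))
    W-period zero    e = ≈-trans (W-prime e) (≈-reflexive (shiftᶜ-cong N (sym ∘ coeff-W-zero p) e))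
    W-period (suc m) e = begin
      coeff (W p (suc m ℕ.+ p)) e        ≡⟨ coeff-W-suc p (m ℕ.+ p) e ⟩
      L p (coeff (W p (m ℕ.+ p))) e      ≈⟨ L-cong≈ p (W-period m) e ⟩
      L p (shiftᶜ N (coeff (W p m))) e   ≈⟨ L-shiftᶜ-N (coeff (W p m)) e ⟩
      shiftᶜ N (L p (coeff (W p m))) e   ≡⟨ shiftᶜ-cong N (sym ∘ coeff-W-suc p m) e ⟩
      shiftᶜ N (coeff (W p (suc m))) e   ∎
      where open import Relation.Binary.Reasoning.Setoid ≈-setoid

    W-periodic : ∀ c r → coeff (W p (r ℕ.+ c ℕ.* p)) ≋ shiftᶜ (c ℕ.* N) (coeff (W p r))
    W-periodic zero    r e = ≈-reflexive (cong (λ m → coeff (W p m) e) (ℕ.+-identityʳ r))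
    W-periodic (suc c) r e = begin
      coeff (W p (r ℕ.+ suc c ℕ.* p)) e               ≡⟨ cong (λ m → coeff (W p m) e) (regroup r c p) ⟩
      coeff (W p (r ℕ.+ c ℕ.* p ℕ.+ p)) e             ≈⟨ W-period (r ℕ.+ c ℕ.* p) e ⟩
      shiftᶜ N (coeff (W p (r ℕ.+ c ℕ.* p))) e        ≈⟨ shiftᶜ-cong≈ N (W-periodic c r) e ⟩
      shiftᶜ N (shiftᶜ (c ℕ.* N) (coeff (W p r))) e   ≡⟨ shiftᶜ-+ N (c ℕ.* N) (coeff (W p r)) e ⟩
      shiftᶜ (suc c ℕ.* N) (coeff (W p r)) e          ∎
      where
      open import Relation.Binary.Reasoning.Setoid ≈-setoid
      open import Data.Nat.Tactic.RingSolver using () renaming (solve-∀ to solveℕ-∀)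
      regroup : ∀ r c p → r ℕ.+ suc c ℕ.* p ≡ r ℕ.+ c ℕ.* p ℕ.+ p
      regroup = solveℕ-∀

    coeff-W-mod-prime : ∀ m → coeff (W p m) ≋ shiftᶜ (N ℕ.* (m / p)) (coeff (W p (m % p)))
    coeff-W-mod-prime m e = begin
      coeff (W p m) e
        ≡⟨ cong (λ n → coeff (W p n) e) (m≡m%n+[m/n]*n m p) ⟩
      coeff (W p (m % p ℕ.+ m / p ℕ.* p)) e
        ≈⟨ W-periodic (m / p) (m % p) e ⟩
      shiftᶜ (m / p ℕ.* N) (coeff (W p (m % p))) e
        ≡⟨ cong (λ n → shiftᶜ n (coeff (W p (m % p))) e) (ℕ.*-comm (m / p) N) ⟩
      shiftᶜ (N ℕ.* (m / p)) (coeff (W p (m % p))) e ∎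
      where open import Relation.Binary.Reasoning.Setoid ≈-setoid

  W-mod-prime : (p : ℕ) → .{{_ : NonZero p}} → Prime p → (m : ℕ) →
                W p m ≡[mod p ] shift (p ℕ.* (p ∸ 1) ℕ.* (m / p)) (W p (m % p))
  W-mod-prime 0             p-prime = contradiction p-prime ¬prime[0]
  W-mod-prime 1             p-prime = contradiction p-prime ¬prime[1]
  W-mod-prime p@(suc (suc r)) p-prime m =
    Modulo.≋-shift⇒≡[mod] p (W p m) (p ℕ.* (p ∸ 1) ℕ.* (m / p)) (W p (m % p)) (AtPrime.coeff-W-mod-prime r p-prime m)

  W-mod-2 : ∀ m → W 2 m ≡[mod 2 ] shift (2 ℕ.* (m / 2)) (per2 (m % 2))
  W-mod-2 m = subst (λ Q → W 2 m ≡[mod 2 ] shift (2 ℕ.* (m / 2)) Q)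
                    (W2≡per2 (m%n<n m 2)) (W-mod-prime 2 (from-yes (prime? 2)) m)
    where
    W2≡per2 : ∀ {i} → i < 2 → W 2 i ≡ per2 i
    W2≡per2 {0} _ = refl
    W2≡per2 {1} _ = refl
    W2≡per2 {suc (suc _)} (s≤s (s≤s ()))

  W-mod-3 : ∀ m → W 3 m ≡[mod 3 ] shift (6 ℕ.* (m / 3)) (per3 (m % 3))
  W-mod-3 m = ≋-shift⇒≡[mod] (W 3 m) (6 ℕ.* (m / 3)) (per3 (m % 3))
    (λ e → ≈-trans (AtPrime.coeff-W-mod-prime 1 (from-yes (prime? 3)) m e)
                   (shiftᶜ-cong≈ (6 ℕ.* (m / 3)) (W3≋per3 (m%n<n m 3)) e))
    where
    open Modulo 3
    W3≋per3 : ∀ {i} → i < 3 → coeff (W 3 i) ≋ coeff (per3 i)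
    W3≋per3 {0} _ _ = ≈-refl
    W3≋per3 {1} _ _ = ≈-refl
    W3≋per3 {2} _ 0 = ≈-by-multiple (- + 1) refl
    W3≋per3 {2} _ 3 = ≈-by-multiple (- + 1) refl
    W3≋per3 {2} _ 1 = ≈-refl
    W3≋per3 {2} _ 2 = ≈-refl
    W3≋per3 {2} _ (suc (suc (suc (suc k)))) = ≈-refl
    W3≋per3 {suc (suc (suc _))} (s≤s (s≤s (s≤s ())))

open import Data.Nat using (ℕ; _*_; _∸_; NonZero)
open import Data.Nat.DivMod using (_/_; _%_)
open import Data.Nat.Primality using (Prime)
open import Data.Product using (_×_; _,_)
open Periodicity using (W-mod-prime; W-mod-2; W-mod-3)

mainTheorem9 : ((p : ℕ) → .{{_ : NonZero p}} → Prime p → (m : ℕ) →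
                 W p m ≡[mod p ] shift (p * (p ∸ 1) * (m / p)) (W p (m % p)))
               × ((m : ℕ) → W 2 m ≡[mod 2 ] shift (2 * (m / 2)) (per2 (m % 2)))
               × ((m : ℕ) → W 3 m ≡[mod 3 ] shift (6 * (m / 3)) (per3 (m % 3)))
mainTheorem9 = W-mod-prime , W-mod-2 , W-mod-3
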